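{- The $k\times k$ grid is isomorphic to a subgraph of $P_3 \cdot P_n$, where $k=\lfloor\sqrt{3n-2}\rfloor$.
   Context: $P_m$ denotes the path on $m$ vertices. The $k\times k$ grid has vertex set $\{1,\dots,k\}^2$ with $(x,y)(x',y')$ an edge iff $|x-x'|+|y-y'|=1$. $G_1\cdot G_2$ denotes the lexicographic product: vertex set $V(G_1)\times V(G_2)$, where distinct $(u_1,u_2),(v_1,v_2)$ are adjacent iff $u_1v_1\in E(G_1)$, or $u_1=v_1$ and $u_2v_2\in E(G_2)$. -}

module Defs where

open import Level using (Level; suc; zero)
open import Data.Nat using (ℕ; _+_; ∣_-_∣)
open import Data.Fin using (Fin; toℕ)
open import Data.Product using (Σ; _×_; _,_)
open import Data.Sum using (_⊎_)
open import Relation.Binary.PropositionalEquality using (_≡_; _≢_)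
open import Function.Definitions using (Injective)

record Graph : Set₁ where
  field
    V   : Set
    Adj : V → V → Set
open Graph public

-- Path P_m on vertices 0..m-1 (shifted from 1..m), consecutive vertices adjacent.
PathGraph : ℕ → Graph
PathGraph m = record
  { V = Fin m
  ; Adj = λ i j → ∣ toℕ i - toℕ j ∣ ≡ 1 }

-- k × k grid: (x,y)(x',y') edge iff |x-x'| + |y-y'| = 1 (coordinates shifted to 0..k-1).
Grid : ℕ → Graph
Grid k = record
  { V = Fin k × Fin k
  ; Adj = λ { (x , y) (x' , y') → ∣ toℕ x - toℕ x' ∣ + ∣ toℕ y - toℕ y' ∣ ≡ 1 } }

Lex : Graph → Graph → Graph
Lex G₁ G₂ = record
  { V = V G₁ × V G₂
  ; Adj = λ { (u₁ , u₂) (v₁ , v₂) →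
      ((u₁ , u₂) ≢ (v₁ , v₂)) ×
      (Adj G₁ u₁ v₁ ⊎ (u₁ ≡ v₁ × Adj G₂ u₂ v₂)) } }

-- G is isomorphic to a (not necessarily induced) subgraph of H:
-- an injective vertex map sending edges to edges.
IsoToSubgraph : Graph → Graph → Set
IsoToSubgraph G H =
  Σ (V G → V H) λ f → Injective _≡_ _≡_ f × (∀ u v → Adj G u v → Adj H (f u) (f v))

module Submission where

-- Write K = k − 1 and cut the grid {0,…,K}² into the antidiagonals x + y = d.  In the lower
-- triangle d ≤ K, classify antidiagonals by their depth K − d mod 3.  Those of depth ≡ 0 go,
-- each as a contiguous block, to the middle copy of P_n.  An antidiagonal e of depth ≡ 1 and
-- its lower neighbour e − 1 (depth ≡ 2) are interleaved in one block of the first copy as the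
-- zigzag path (0,e),(0,e−1),(1,e−1),(1,e−2),…, i.e. at offsets 2x and 2x + 1.  Moving one step
-- along the grid raises d by one, hence either changes copy or is a zigzag step.  The upper
-- triangle is the 180° rotation of the lower one and is placed likewise in the third copy and
-- in the rest of the middle copy.  Adding up the block lengths, each of the three copies needs
-- at most ((K + 1)² + 2)/3 ≤ n vertices.

open import Defs
open import Data.Nat using (ℕ; zero; suc; _+_; _*_; _∸_; _≤_; _<_; z≤n; s≤s; s≤s⁻¹; _≤?_; ∣_-_∣)
open import Data.Nat.Properties
open import Data.Nat.Tactic.RingSolver using (solve-∀)
open import Data.Fin using (Fin; toℕ; fromℕ<)
open import Data.Fin.Patterns using (0F; 1F; 2F)
open import Data.Fin.Properties using (toℕ-fromℕ<; toℕ-injective; toℕ<n)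
open import Data.Product using (_×_; _,_; proj₁; proj₂)
open import Data.Sum using (_⊎_; inj₁; inj₂)
open import Data.Unit using (⊤; tt)
open import Data.Empty using (⊥; ⊥-elim)
open import Function.Definitions using (Injective)
open import Relation.Nullary using (¬_; yes; no; contradiction)
open import Relation.Binary.PropositionalEquality

LexAdj : ∀ {m} → Fin m × ℕ → Fin m × ℕ → Set
LexAdj (l , p) (l' , p') = ∣ toℕ l - toℕ l' ∣ ≡ 1 ⊎ (l ≡ l' × ∣ p - p' ∣ ≡ 1)

LexAdj-sym : ∀ {m} (u v : Fin m × ℕ) → LexAdj u v → LexAdj v u
LexAdj-sym (l , _) (l' , _) (inj₁ d)          = inj₁ (trans (∣-∣-comm (toℕ l') (toℕ l)) d)
LexAdj-sym (_ , p) (_ , p') (inj₂ (refl , d)) = inj₂ (refl , trans (∣-∣-comm p' p) d)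

LexAdj-irrefl : ∀ {m} (u : Fin m × ℕ) → ¬ LexAdj u u
LexAdj-irrefl (l , _) (inj₁ d) with () ← trans (sym (∣n-n∣≡0 (toℕ l))) d
LexAdj-irrefl (_ , p) (inj₂ (_ , d)) with () ← trans (sym (∣n-n∣≡0 p)) d

module _ {k m N : ℕ} (place : Fin k × Fin k → Fin m × ℕ)
         (bounded : ∀ u → proj₂ (place u) < N)
         (injective : Injective _≡_ _≡_ place)
         (adjacent : ∀ u v → Adj (Grid k) u v → LexAdj (place u) (place v)) where

  private
    embed : Fin k × Fin k → Fin m × Fin N
    embed u = proj₁ (place u) , fromℕ< (bounded u)

    forget : Fin m × Fin N → Fin m × ℕ
    forget (l , p) = l , toℕ p

    forget-embed : ∀ u → forget (embed u) ≡ place u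
    forget-embed u = cong (proj₁ (place u) ,_) (toℕ-fromℕ< (bounded u))

    embed-injective : Injective _≡_ _≡_ embed
    embed-injective {u} {v} e =
      injective (trans (sym (forget-embed u)) (trans (cong forget e) (forget-embed v)))

    embed-adjacent : ∀ u v → Adj (Grid k) u v →
                     Adj (Lex (PathGraph m) (PathGraph N)) (embed u) (embed v)
    embed-adjacent u v a = distinct , adj
      where
      adj : LexAdj (forget (embed u)) (forget (embed v))
      adj = subst₂ LexAdj (sym (forget-embed u)) (sym (forget-embed v)) (adjacent u v a)

      distinct : embed u ≢ embed v
      distinct e = LexAdj-irrefl (forget (embed u))
                                 (subst (LexAdj (forget (embed u))) (cong forget (sym e)) adj)

  placement⇒IsoToSubgraph : IsoToSubgraph (Grid k) (Lex (PathGraph m) (PathGraph N))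
  placement⇒IsoToSubgraph = embed , embed-injective , embed-adjacent

Grid0-embeds : ∀ H → IsoToSubgraph (Grid 0) H
Grid0-embeds H = (λ { (() , _) }) , (λ { {() , _} }) , (λ { (() , _) })

data Step : ℕ × ℕ → ℕ × ℕ → Set where
  right : ∀ {x y} → Step (x , y) (suc x , y)
  up    : ∀ {x y} → Step (x , y) (x , suc y)

m+n≡1⇒cases : ∀ m n → m + n ≡ 1 → (m ≡ 0 × n ≡ 1) ⊎ (m ≡ 1 × n ≡ 0)
m+n≡1⇒cases zero          n    e  = inj₁ (refl , e)
m+n≡1⇒cases (suc zero)    zero _  = inj₂ (refl , refl)
m+n≡1⇒cases (suc zero)    (suc n) ()
m+n≡1⇒cases (suc (suc m)) n    ()

∣m-n∣≡1⇒n≡1+m⊎m≡1+n : ∀ m n → ∣ m - n ∣ ≡ 1 → n ≡ suc m ⊎ m ≡ suc n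
∣m-n∣≡1⇒n≡1+m⊎m≡1+n zero          (suc zero)    _ = inj₁ refl
∣m-n∣≡1⇒n≡1+m⊎m≡1+n (suc zero)    zero          _ = inj₂ refl
∣m-n∣≡1⇒n≡1+m⊎m≡1+n (suc m)       (suc n)       e with ∣m-n∣≡1⇒n≡1+m⊎m≡1+n m n e
... | inj₁ n≡1+m = inj₁ (cong suc n≡1+m)
... | inj₂ m≡1+n = inj₂ (cong suc m≡1+n)
∣m-n∣≡1⇒n≡1+m⊎m≡1+n zero          zero          ()
∣m-n∣≡1⇒n≡1+m⊎m≡1+n zero          (suc (suc n)) ()
∣m-n∣≡1⇒n≡1+m⊎m≡1+n (suc (suc m)) zero          ()

grid-step : ∀ x y x' y' → ∣ x - x' ∣ + ∣ y - y' ∣ ≡ 1 →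
            Step (x , y) (x' , y') ⊎ Step (x' , y') (x , y)
grid-step x y x' y' e with m+n≡1⇒cases ∣ x - x' ∣ ∣ y - y' ∣ e
... | inj₁ (dx , dy)
  with ∣m-n∣≡0⇒m≡n {x} {x'} dx | ∣m-n∣≡1⇒n≡1+m⊎m≡1+n y y' dy
...   | refl | inj₁ refl = inj₁ up
...   | refl | inj₂ refl = inj₂ up
grid-step x y x' y' e | inj₂ (dx , dy)
  with ∣m-n∣≡1⇒n≡1+m⊎m≡1+n x x' dx | ∣m-n∣≡0⇒m≡n {y} {y'} dy
...   | inj₁ refl | refl = inj₁ right
...   | inj₂ refl | refl = inj₂ right

step-sum : ∀ {x y x' y'} → Step (x , y) (x' , y') → x' + y' ≡ suc (x + y)
step-sum right = refl
step-sum {x} {y} up = +-suc x y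

-- The phase of an antidiagonal is its depth K − (x + y) mod 3.
data Phase : Set where
  midRow zigRow zagRow : Phase

next : Phase → Phase
next midRow = zigRow
next zigRow = zagRow
next zagRow = midRow

phase : ℕ → Phase
phase zero                = midRow
phase (suc zero)          = zigRow
phase (suc (suc zero))    = zagRow
phase (suc (suc (suc t))) = phase t

residue : Phase → ℕ
residue midRow = 0
residue zigRow = 1
residue zagRow = 2

quot3 : ℕ → ℕ
quot3 (suc (suc (suc t))) = suc (quot3 t)
quot3 _                   = 0

quot3*3+residue≡id : ∀ t → quot3 t * 3 + residue (phase t) ≡ t
quot3*3+residue≡id zero                = refl
quot3*3+residue≡id (suc zero)          = refl
quot3*3+residue≡id (suc (suc zero))    = refl
quot3*3+residue≡id (suc (suc (suc t))) = cong (λ s → suc (suc (suc s))) (quot3*3+residue≡id t)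

phase-suc : ∀ t → phase (suc t) ≡ next (phase t)
phase-suc zero                = refl
phase-suc (suc zero)          = refl
phase-suc (suc (suc zero))    = refl
phase-suc (suc (suc (suc t))) = phase-suc t

-- preceding g v = g (v − 3) + g (v − 6) + ⋯ is where block v starts when the blocks of one
-- residue class, of lengths g, are laid out in increasing order.
preceding : (ℕ → ℕ) → ℕ → ℕ
preceding g (suc (suc (suc v))) = preceding g v + g v
preceding g _                   = 0

preceding-bound : ∀ g {u v m} j → j * 3 + u ≡ v → m < g u →
                  preceding g u + m < preceding g (3 + v)
preceding-bound g {u} zero    refl m<g = +-monoʳ-< (preceding g u) m<g
preceding-bound g     (suc j) refl m<g = <-≤-trans (preceding-bound g j refl m<g) (m≤m+n _ _)

preceding-injective : ∀ g {u u' m m'} j j' → j * 3 + u ≡ j' * 3 + u' →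
                      m < g u → m' < g u' → preceding g u + m ≡ preceding g u' + m' →
                      u ≡ u' × m ≡ m'
preceding-injective g {u} zero zero refl _ _ e = refl , +-cancelˡ-≡ (preceding g u) _ _ e
preceding-injective g (suc j) (suc j') e =
  preceding-injective g j j' (suc-injective (suc-injective (suc-injective e)))
preceding-injective g {m = m} zero (suc j') refl _ m'<g e =
  contradiction (<-≤-trans (preceding-bound g j' refl m'<g) (m≤m+n _ m)) (<-irrefl (sym e))
preceding-injective g {m' = m'} (suc j) zero refl m<g _ e =
  contradiction (<-≤-trans (preceding-bound g j refl m<g) (m≤m+n _ m')) (<-irrefl e)

private
  square-step : ∀ n → (suc n * suc n + 2) + 3 * (2 * n + 5) ≡ (4 + n) * (4 + n) + 2
  square-step = solve-∀

3*f≤[1+n]²+2 : (f : ℕ → ℕ) → f 0 ≤ 1 → f 1 ≤ 2 → f 2 ≤ 3 →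
               (∀ n → f (3 + n) ≡ f n + (2 * n + 5)) →
               ∀ n → 3 * f n ≤ suc n * suc n + 2
3*f≤[1+n]²+2 f f0 f1 f2 step zero             = *-monoʳ-≤ 3 f0
3*f≤[1+n]²+2 f f0 f1 f2 step (suc zero)       = *-monoʳ-≤ 3 f1
3*f≤[1+n]²+2 f f0 f1 f2 step (suc (suc zero)) = ≤-trans (*-monoʳ-≤ 3 f2) (m≤m+n 9 2)
3*f≤[1+n]²+2 f f0 f1 f2 step (suc (suc (suc n))) = begin
  3 * f (3 + n)                               ≡⟨ cong (3 *_) (step n) ⟩
  3 * (f n + (2 * n + 5))                     ≡⟨ *-distribˡ-+ 3 (f n) _ ⟩
  3 * f n + 3 * (2 * n + 5)                   ≤⟨ +-monoˡ-≤ _ (3*f≤[1+n]²+2 f f0 f1 f2 step n) ⟩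
  (suc n * suc n + 2) + 3 * (2 * n + 5)       ≡⟨ square-step n ⟩
  (4 + n) * (4 + n) + 2                       ∎
  where open ≤-Reasoning

sideSize : ℕ → ℕ
sideSize e = suc (2 * e)

sideStart centreStart : ℕ → ℕ
sideStart   = preceding sideSize
centreStart = preceding suc

sideStart-capacity : ∀ K → 3 * sideStart (2 + K) ≤ suc K * suc K + 2
sideStart-capacity = 3*f≤[1+n]²+2 (λ K → sideStart (2 + K)) z≤n (s≤s z≤n) ≤-refl
  λ n → cong (sideStart (2 + n) +_) (lengths n)
  where
  lengths : ∀ n → suc (2 * (2 + n)) ≡ 2 * n + 5
  lengths = solve-∀

centreStart-capacity : ∀ K → 3 * (centreStart (3 + K) + centreStart K) ≤ suc K * suc K + 2
centreStart-capacity =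
  3*f≤[1+n]²+2 (λ K → centreStart (3 + K) + centreStart K) ≤-refl ≤-refl ≤-refl
    λ n → regroup (centreStart (3 + n)) (centreStart n) n
  where
  regroup : ∀ a b n → (a + suc (3 + n)) + (b + suc n) ≡ (a + b) + (2 * n + 5)
  regroup = solve-∀

-- Cells of the lower triangle

data Cell : Set where
  side centre : ℕ → Cell

CellAdj : Cell → Cell → Set
CellAdj (side p)   (side p')   = ∣ p - p' ∣ ≡ 1
CellAdj (centre _) (centre _)  = ⊥
CellAdj _          _           = ⊤

CellAdj-sym : ∀ {c c'} → CellAdj c c' → CellAdj c' c
CellAdj-sym {side p}   {side p'}   d  = trans (∣-∣-comm p' p) d
CellAdj-sym {side _}   {centre _}  tt = tt
CellAdj-sym {centre _} {side _}    tt = tt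

cell : Phase → ℕ → ℕ → Cell
cell midRow x y = centre (centreStart (x + y) + x)
cell zigRow x y = side (sideStart (x + y) + 2 * x)
cell zagRow x y = side (sideStart (suc (x + y)) + suc (2 * x))

position : Cell → ℕ
position (side p)   = p
position (centre p) = p

Fits : (sideBound centreBound : ℕ) → Cell → Set
Fits sideBound _ (side p)   = p < sideBound
Fits _ centreBound (centre p) = p < centreBound

module _ (x y : ℕ) where

  centre-offset< : x < suc (x + y)
  centre-offset< = s≤s (m≤m+n x y)

  zig-offset< : 2 * x < sideSize (x + y)
  zig-offset< = s≤s (*-monoʳ-≤ 2 (m≤m+n x y))

  zag-offset< : suc (2 * x) < sideSize (suc (x + y))
  zag-offset< = s≤s (*-monoʳ-< 2 centre-offset<)

∣n-1+n∣≡1 : ∀ n → ∣ n - suc n ∣ ≡ 1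
∣n-1+n∣≡1 n = trans (cong ∣ n -_∣ (+-comm 1 n)) (∣m-m+n∣≡n n 1)

cell-adjacent : ∀ c {x y x' y'} → Step (x , y) (x' , y') →
                CellAdj (cell (next c) x y) (cell c x' y')
cell-adjacent midRow _ = tt
cell-adjacent zagRow _ = tt
cell-adjacent zigRow {x} {y} right =
  trans (∣m+n-m+o∣≡∣n-o∣ (sideStart (suc (x + y))) (suc (2 * x)) (2 * suc x))
        (trans (cong ∣ suc (2 * x) -_∣ (*-suc 2 x)) (∣n-1+n∣≡1 (2 * x)))
cell-adjacent zigRow {x} {y} up rewrite +-suc x y =
  trans (∣m+n-m+o∣≡∣n-o∣ (sideStart (suc (x + y))) (suc (2 * x)) (2 * x))
        (trans (∣-∣-comm (suc (2 * x)) (2 * x)) (∣n-1+n∣≡1 (2 * x)))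

module _ {K : ℕ} where

  private
    drop-suc : ∀ a b a' b' → a + suc b ≡ a' + suc b' → a + b ≡ a' + b'
    drop-suc a b a' b' e = suc-injective (trans (sym (+-suc a b)) (trans e (+-suc a' b')))

    coordinates : ∀ {x y x' y'} → x ≡ x' → x + y ≡ x' + y' → x ≡ x' × y ≡ y'
    coordinates {x} refl e = refl , +-cancelˡ-≡ x _ _ e

    side-fits : ∀ q {e m} → q * 3 + suc e ≡ K → m < sideSize e →
                sideStart e + m < sideStart (2 + K)
    side-fits q {e} h m<s =
      subst (λ w → _ < sideStart (suc (suc w))) (trans (sym (+-suc (q * 3) e)) h)
            (preceding-bound sideSize q refl m<s)

  cell-injective : ∀ c c' {q q' x y x' y'} →
                   q * 3 + (residue c + (x + y)) ≡ K → q' * 3 + (residue c' + (x' + y')) ≡ K →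
                   cell c x y ≡ cell c' x' y' → x ≡ x' × y ≡ y'
  cell-injective midRow midRow {q} {q'} {x} {y} {x'} {y'} h h' e
    with preceding-injective suc q q' (trans h (sym h'))
                             (centre-offset< x y) (centre-offset< x' y') (cong position e)
  ... | d≡d' , x≡x' = coordinates x≡x' d≡d'
  cell-injective zigRow zigRow {q} {q'} {x} {y} {x'} {y'} h h' e
    with preceding-injective sideSize q q' (drop-suc _ _ _ _ (trans h (sym h')))
                             (zig-offset< x y) (zig-offset< x' y') (cong position e)
  ... | d≡d' , 2x≡2x' = coordinates (*-cancelˡ-≡ x x' 2 2x≡2x') d≡d'
  cell-injective zagRow zagRow {q} {q'} {x} {y} {x'} {y'} h h' e
    with preceding-injective sideSize q q' (drop-suc _ _ _ _ (trans h (sym h')))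
                             (zag-offset< x y) (zag-offset< x' y') (cong position e)
  ... | 1+d≡1+d' , 1+2x≡1+2x' =
    coordinates (*-cancelˡ-≡ x x' 2 (suc-injective 1+2x≡1+2x')) (suc-injective 1+d≡1+d')
  cell-injective zigRow zagRow {q} {q'} {x} {y} {x'} {y'} h h' e
    with preceding-injective sideSize q q' (drop-suc _ _ _ _ (trans h (sym h')))
                             (zig-offset< x y) (zag-offset< x' y') (cong position e)
  ... | _ , 2x≡1+2x' = contradiction 2x≡1+2x' (even≢odd x x')
  cell-injective zagRow zigRow {q} {q'} {x} {y} {x'} {y'} h h' e
    with preceding-injective sideSize q' q (drop-suc _ _ _ _ (trans h' (sym h)))
                             (zig-offset< x' y') (zag-offset< x y) (cong position (sym e))
  ... | _ , 2x'≡1+2x = contradiction 2x'≡1+2x (even≢odd x' x)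
  cell-injective midRow zigRow h h' ()
  cell-injective midRow zagRow h h' ()
  cell-injective zigRow midRow h h' ()
  cell-injective zagRow midRow h h' ()

  cell-fits : ∀ c q {x y} → q * 3 + (residue c + (x + y)) ≡ K →
              Fits (sideStart (2 + K)) (centreStart (3 + K)) (cell c x y)
  cell-fits midRow q {x} {y} h = preceding-bound suc q h (centre-offset< x y)
  cell-fits zigRow q {x} {y} h = side-fits q h (zig-offset< x y)
  cell-fits zagRow q {x} {y} h = side-fits q h (zag-offset< x y)

  cell-fits-off-rim : ∀ c q {x y} → q * 3 + (residue c + (x + y)) ≡ K → 0 < q * 3 + residue c →
                   Fits (sideStart (2 + K)) (centreStart K) (cell c x y)
  cell-fits-off-rim midRow (suc q) {x} {y} refl _ = preceding-bound suc q refl (centre-offset< x y)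
  cell-fits-off-rim zigRow q {x} {y} h _ = cell-fits zigRow q {x} {y} h
  cell-fits-off-rim zagRow q {x} {y} h _ = cell-fits zagRow q {x} {y} h

-- The lower triangle and its rotation

module Triangle (K : ℕ) where

  lowerCell : ℕ → ℕ → Cell
  lowerCell x y = cell (phase (K ∸ (x + y))) x y

  lowerCell-depth : ∀ t {x y} → t + (x + y) ≡ K → lowerCell x y ≡ cell (phase t) x y
  lowerCell-depth t {x} {y} h =
    cong (λ s → cell (phase s) x y) (trans (cong (_∸ (x + y)) (sym h)) (m+n∸n≡m t (x + y)))

  private
    invariant : ∀ x y → x + y ≤ K →
                let t = K ∸ (x + y) in quot3 t * 3 + (residue (phase t) + (x + y)) ≡ K
    invariant x y le = begin
      q * 3 + (residue (phase t) + (x + y)) ≡⟨ +-assoc (q * 3) _ (x + y) ⟨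
      q * 3 + residue (phase t) + (x + y)   ≡⟨ cong (_+ (x + y)) (quot3*3+residue≡id t) ⟩
      t + (x + y)                           ≡⟨ m∸n+n≡m le ⟩
      K                                     ∎
      where
      open ≡-Reasoning
      t = K ∸ (x + y)
      q = quot3 t

  lowerCell-injective : ∀ {x y x' y'} → x + y ≤ K → x' + y' ≤ K →
                        lowerCell x y ≡ lowerCell x' y' → x ≡ x' × y ≡ y'
  lowerCell-injective {x} {y} {x'} {y'} le le' =
    cell-injective (phase (K ∸ (x + y))) (phase (K ∸ (x' + y')))
                   {quot3 (K ∸ (x + y))} {quot3 (K ∸ (x' + y'))}
                   (invariant x y le) (invariant x' y' le')

  lowerCell-fits : ∀ {x y} → x + y ≤ K →
                   Fits (sideStart (2 + K)) (centreStart (3 + K)) (lowerCell x y)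
  lowerCell-fits {x} {y} le =
    cell-fits (phase (K ∸ (x + y))) (quot3 (K ∸ (x + y))) (invariant x y le)

  lowerCell-fits-off-rim : ∀ {x y} → x + y < K →
                        Fits (sideStart (2 + K)) (centreStart K) (lowerCell x y)
  lowerCell-fits-off-rim {x} {y} lt =
    cell-fits-off-rim (phase (K ∸ (x + y))) (quot3 (K ∸ (x + y))) (invariant x y (<⇒≤ lt))
      (subst (0 <_) (sym (quot3*3+residue≡id (K ∸ (x + y)))) (m<n⇒0<n∸m lt))

  lowerCell-adjacent : ∀ {x y x' y'} → Step (x , y) (x' , y') → x' + y' ≤ K →
                       CellAdj (lowerCell x y) (lowerCell x' y')
  lowerCell-adjacent {x} {y} {x'} {y'} s le =
    subst (λ c → CellAdj c (lowerCell x' y')) (sym one-deeper) (cell-adjacent (phase t) s)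
    where
    t = K ∸ (x' + y')
    depth : suc t + (x + y) ≡ K
    depth = begin
      suc t + (x + y) ≡⟨ +-suc t (x + y) ⟨
      t + suc (x + y) ≡⟨ cong (t +_) (step-sum s) ⟨
      t + (x' + y')   ≡⟨ m∸n+n≡m le ⟩
      K               ∎
      where open ≡-Reasoning
    one-deeper : lowerCell x y ≡ cell (next (phase t)) x y
    one-deeper = trans (lowerCell-depth (suc t) depth) (cong (λ c → cell c x y) (phase-suc t))

  rotate-step : ∀ {x y x' y'} → x' ≤ K → y' ≤ K → Step (x , y) (x' , y') →
                Step (K ∸ x' , K ∸ y') (K ∸ x , K ∸ y)
  rotate-step {x} {y} x'≤K _ right =
    subst (λ z → Step (K ∸ suc x , K ∸ y) (z , K ∸ y)) (sym (+-∸-assoc 1 x'≤K)) right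
  rotate-step {x} {y} _ y'≤K up =
    subst (λ z → Step (K ∸ x , K ∸ suc y) (K ∸ x , z)) (sym (+-∸-assoc 1 y'≤K)) up

  rotate-sum : ∀ {x y} → x ≤ K → y ≤ K → (K ∸ x) + (K ∸ y) + (x + y) ≡ K + K
  rotate-sum {x} {y} x≤K y≤K = begin
    (K ∸ x) + (K ∸ y) + (x + y)   ≡⟨ regroup (K ∸ x) (K ∸ y) x y ⟩
    (K ∸ x + x) + (K ∸ y + y)     ≡⟨ cong₂ _+_ (m∸n+n≡m x≤K) (m∸n+n≡m y≤K) ⟩
    K + K                         ∎
    where
    open ≡-Reasoning
    regroup : ∀ a b c d → a + b + (c + d) ≡ (a + c) + (b + d)
    regroup = solve-∀

  rotate-sum< : ∀ {x y} → x ≤ K → y ≤ K → K < x + y → (K ∸ x) + (K ∸ y) < K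
  rotate-sum< {x} {y} x≤K y≤K lt = +-cancelʳ-< (x + y) _ K
    (subst (_< K + (x + y)) (sym (rotate-sum x≤K y≤K)) (+-monoʳ-< K lt))

  rotate-sum≡ : ∀ {x y} → x ≤ K → y ≤ K → x + y ≡ K → (K ∸ x) + (K ∸ y) ≡ K
  rotate-sum≡ {x} {y} x≤K y≤K e = +-cancelʳ-≡ K _ K
    (subst (λ d → (K ∸ x) + (K ∸ y) + d ≡ K + K) e (rotate-sum x≤K y≤K))

-- Placing the grid in P₃ · P_N

module Placement (K N : ℕ) (side-capacity : sideStart (2 + K) ≤ N)
                 (centre-capacity : centreStart (3 + K) + centreStart K ≤ N) where

  open Triangle K

  -- The lower triangle occupies the first centreStart (3 + K) positions of the centre copy.
  lowerPlace upperPlace : Cell → Fin 3 × ℕ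
  lowerPlace (side p)   = 0F , p
  lowerPlace (centre p) = 1F , p
  upperPlace (side p)   = 2F , p
  upperPlace (centre p) = 1F , centreStart (3 + K) + p

  lowerPlace-adjacent : ∀ {c c'} → CellAdj c c' → LexAdj (lowerPlace c) (lowerPlace c')
  lowerPlace-adjacent {side _}   {side _}   d  = inj₂ (refl , d)
  lowerPlace-adjacent {side _}   {centre _} tt = inj₁ refl
  lowerPlace-adjacent {centre _} {side _}   tt = inj₁ refl

  upperPlace-adjacent : ∀ {c c'} → CellAdj c c' → LexAdj (upperPlace c) (upperPlace c')
  upperPlace-adjacent {side _}   {side _}   d  = inj₂ (refl , d)
  upperPlace-adjacent {side _}   {centre _} tt = inj₁ refl
  upperPlace-adjacent {centre _} {side _}   tt = inj₁ refl

  lowerPlace-injective : ∀ {c c'} → lowerPlace c ≡ lowerPlace c' → c ≡ c'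
  lowerPlace-injective {side _}   {side _}   refl = refl
  lowerPlace-injective {centre _} {centre _} refl = refl

  upperPlace-injective : ∀ {c c'} → upperPlace c ≡ upperPlace c' → c ≡ c'
  upperPlace-injective {side _}   {side _}   refl = refl
  upperPlace-injective {centre p} {centre p'} e =
    cong centre (+-cancelˡ-≡ (centreStart (3 + K)) p p' (cong proj₂ e))

  lowerPlace≢upperPlace : ∀ {c c'} → Fits (sideStart (2 + K)) (centreStart (3 + K)) c →
                          lowerPlace c ≢ upperPlace c'
  lowerPlace≢upperPlace {centre p} {centre p'} p<M e =
    <-irrefl (cong proj₂ e) (<-≤-trans p<M (m≤m+n _ p'))
  lowerPlace≢upperPlace {side _}   {side _} _ ()
  lowerPlace≢upperPlace {centre _} {side _} _ ()

  lowerPlace-bounded : ∀ {c} → Fits (sideStart (2 + K)) (centreStart (3 + K)) c →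
                       proj₂ (lowerPlace c) < N
  lowerPlace-bounded {side _}   p<S = <-≤-trans p<S side-capacity
  lowerPlace-bounded {centre _} p<M = <-≤-trans p<M (≤-trans (m≤m+n _ _) centre-capacity)

  upperPlace-bounded : ∀ {c} → Fits (sideStart (2 + K)) (centreStart K) c →
                       proj₂ (upperPlace c) < N
  upperPlace-bounded {side _}   p<S = <-≤-trans p<S side-capacity
  upperPlace-bounded {centre _} p<C =
    <-≤-trans (+-monoʳ-< (centreStart (3 + K)) p<C) centre-capacity

  private
    rotated< : ∀ {x y} → x ≤ K → y ≤ K → ¬ (x + y ≤ K) → (K ∸ x) + (K ∸ y) < K
    rotated< x≤K y≤K nle = rotate-sum< x≤K y≤K (≰⇒> nle)

  place : ℕ → ℕ → Fin 3 × ℕ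
  place x y with x + y ≤? K
  ... | yes _ = lowerPlace (lowerCell x y)
  ... | no  _ = upperPlace (lowerCell (K ∸ x) (K ∸ y))

  place-bounded : ∀ {x y} → x ≤ K → y ≤ K → proj₂ (place x y) < N
  place-bounded {x} {y} x≤K y≤K with x + y ≤? K
  ... | yes le = lowerPlace-bounded (lowerCell-fits {x} {y} le)
  ... | no nle = upperPlace-bounded (lowerCell-fits-off-rim {K ∸ x} {K ∸ y} (rotated< x≤K y≤K nle))

  place-injective : ∀ {x y x' y'} → x ≤ K → y ≤ K → x' ≤ K → y' ≤ K →
                    place x y ≡ place x' y' → x ≡ x' × y ≡ y'
  place-injective {x} {y} {x'} {y'} x≤K y≤K x'≤K y'≤K e with x + y ≤? K | x' + y' ≤? K
  ... | yes le | yes le' = lowerCell-injective le le' (lowerPlace-injective e)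
  ... | yes le | no _    = ⊥-elim (lowerPlace≢upperPlace (lowerCell-fits {x} {y} le) e)
  ... | no _   | yes le' = ⊥-elim (lowerPlace≢upperPlace (lowerCell-fits {x'} {y'} le') (sym e))
  ... | no nle | no nle'
    with lowerCell-injective (<⇒≤ (rotated< x≤K y≤K nle)) (<⇒≤ (rotated< x'≤K y'≤K nle'))
                             (upperPlace-injective e)
  ...   | ex , ey = ∸-cancelˡ-≡ x≤K x'≤K ex , ∸-cancelˡ-≡ y≤K y'≤K ey

  place-adjacent : ∀ {x y x' y'} → x ≤ K → y ≤ K → x' ≤ K → y' ≤ K →
                   Step (x , y) (x' , y') → LexAdj (place x y) (place x' y')
  place-adjacent {x} {y} {x'} {y'} x≤K y≤K x'≤K y'≤K s with x + y ≤? K | x' + y' ≤? K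
  ... | yes _  | yes le' = lowerPlace-adjacent (lowerCell-adjacent s le')
  ... | no nle | yes le' = ⊥-elim (nle (≤-trans (n≤1+n _) (subst (_≤ K) (step-sum s) le')))
  ... | no nle | no _    =
    upperPlace-adjacent (CellAdj-sym (lowerCell-adjacent (rotate-step x'≤K y'≤K s)
                                                          (<⇒≤ (rotated< x≤K y≤K nle))))
  ... | yes le | no nle' =
    subst₂ LexAdj (cong lowerPlace (sym rim)) (cong upperPlace (sym rim′)) (inj₁ refl)
    where
    on-rim : x + y ≡ K
    on-rim = ≤-antisym le (s≤s⁻¹ (subst (K <_) (step-sum s) (≰⇒> nle')))
    rim : lowerCell x y ≡ cell midRow x y
    rim = lowerCell-depth 0 {x} {y} on-rim
    rim′ : lowerCell (K ∸ x') (K ∸ y') ≡ cell zigRow (K ∸ x') (K ∸ y')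
    rim′ = lowerCell-depth 1 {K ∸ x'} {K ∸ y'}
             (trans (sym (step-sum (rotate-step x'≤K y'≤K s))) (rotate-sum≡ x≤K y≤K on-rim))

  grid-embedding : IsoToSubgraph (Grid (suc K)) (Lex (PathGraph 3) (PathGraph N))
  grid-embedding = placement⇒IsoToSubgraph placeGrid bounded injective adjacent
    where
    placeGrid : Fin (suc K) × Fin (suc K) → Fin 3 × ℕ
    placeGrid (a , b) = place (toℕ a) (toℕ b)

    ≤K : (a : Fin (suc K)) → toℕ a ≤ K
    ≤K a = s≤s⁻¹ (toℕ<n a)

    bounded : ∀ u → proj₂ (placeGrid u) < N
    bounded (a , b) = place-bounded (≤K a) (≤K b)

    injective : Injective _≡_ _≡_ placeGrid
    injective {a , b} {a' , b'} e with place-injective (≤K a) (≤K b) (≤K a') (≤K b') e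
    ... | ea , eb = cong₂ _,_ (toℕ-injective ea) (toℕ-injective eb)

    adjacent : ∀ u v → Adj (Grid (suc K)) u v → LexAdj (placeGrid u) (placeGrid v)
    adjacent (a , b) (a' , b') d with grid-step (toℕ a) (toℕ b) (toℕ a') (toℕ b') d
    ... | inj₁ s = place-adjacent (≤K a) (≤K b) (≤K a') (≤K b') s
    ... | inj₂ s = LexAdj-sym (placeGrid (a' , b')) (placeGrid (a , b))
                              (place-adjacent (≤K a') (≤K b') (≤K a) (≤K b) s)

lemma18 : (n k : ℕ) → 1 ≤ n →
    k * k ≤ 3 * n ∸ 2 → 3 * n ∸ 2 < suc k * suc k →
    IsoToSubgraph (Grid k) (Lex (PathGraph 3) (PathGraph n))
lemma18 n zero    _   _  _ = Grid0-embeds (Lex (PathGraph 3) (PathGraph n))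
lemma18 n (suc K) 1≤n k²≤ _ = grid-embedding
  where
  capacity : suc K * suc K + 2 ≤ 3 * n
  capacity = ≤-trans (+-monoˡ-≤ 2 k²≤)
                     (≤-reflexive (m∸n+n≡m (≤-trans (n≤1+n 2) (*-monoʳ-≤ 3 1≤n))))
  open Placement K n (*-cancelˡ-≤ 3 (≤-trans (sideStart-capacity K) capacity))
                     (*-cancelˡ-≤ 3 (≤-trans (centreStart-capacity K) capacity))
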